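{- For integers $p_1,p_2\ge 0$, the edge set of every digraph $D\in D(p_1+p_2,p_1+p_2)$ can be partitioned into the edge sets of two subgraphs $D_1\in D(p_1,p_1)$ and $D_2\in D(p_2,p_2)$.
   Context: All digraphs are finite, without loops and without parallel edges. For integers $k,\ell\ge 0$, $D(k,\ell)$ denotes the family of digraphs in which every vertex $v$ satisfies $d^-(v)\le k$ or $d^+(v)\le \ell$ (indegree at most $k$ or outdegree at most $\ell$). Subgraphs are taken on the same vertex set, determined by their edge sets. -}

module Defs where

open import Data.Nat using (ℕ; _≤_)
open import Data.Fin using (Fin)
open import Data.Bool using (Bool; true; false)
open import Data.Sum using (_⊎_)
open import Data.Product using (_×_)
open import Relation.Binary.PropositionalEquality using (_≡_)
open import Data.Vec using (count; allFin)
open import Relation.Nullary using (Dec)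
open import Data.Bool.Properties using (_≟_)

-- A digraph on vertex set Fin n: edge u → v present iff E u v ≡ true.
-- No parallel edges by construction; loops are excluded by Loopless.
Digraph : ℕ → Set
Digraph n = Fin n → Fin n → Bool

Loopless : ∀ {n} → Digraph n → Set
Loopless {n} E = (v : Fin n) → E v v ≡ false

indeg : ∀ {n} → Digraph n → Fin n → ℕ
indeg {n} E v = count (λ u → E u v ≟ true) (allFin n)

outdeg : ∀ {n} → Digraph n → Fin n → ℕ
outdeg {n} E v = count (λ w → E v w ≟ true) (allFin n)

InD : ∀ {n} → ℕ → ℕ → Digraph n → Set
InD {n} k ℓ E = (v : Fin n) → indeg E v ≤ k ⊎ outdeg E v ≤ ℓ

EdgePartition : ∀ {n} → Digraph n → Digraph n → Digraph n → Set
EdgePartition {n} E E₁ E₂ = (u v : Fin n) →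
  (E u v ≡ true × ((E₁ u v ≡ true × E₂ u v ≡ false) ⊎ (E₁ u v ≡ false × E₂ u v ≡ true)))
  ⊎ (E u v ≡ false × E₁ u v ≡ false × E₂ u v ≡ false)

module Submission where

-- Call a vertex an in-vertex if its indegree is at most p₁ + p₂, and an out-vertex
-- otherwise (then its outdegree is at most p₁ + p₂).  Every vertex only has to control the
-- edges on its own side: an in-vertex its in-edges, an out-vertex its out-edges.  So it is
-- enough to 2-colour the edges so that every vertex sees, on its own side, at most p₁ edges
-- of colour true and at most p₂ of colour false; the two colour classes are D₁ and D₂.
-- An edge is seen by at most two vertices, and if by two then by one in- and one
-- out-vertex: this is the capacitated edge-colouring problem on a bipartite structure.
--
-- A new edge receives a
-- colour that is free at one of its viewers; the other viewer may become one unit over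
-- capacity.  Such an excess is repaired by an alternating-path argument (Repair): starting
-- from the overloaded vertex we explore the edges along which units can be passed on,
-- flipping their colours, until a vertex with spare room (or an edge seen from one end only)
-- absorbs the unit; if the explored set closes up first, double counting the edges between
-- its two sides contradicts the capacities.

open import Defs
open import Data.Nat using (ℕ; zero; suc; _+_; _*_; _≤_; _<_; z≤n; z<s; _≤?_; _<?_)
open import Data.Nat.Properties
open import Data.Fin using (Fin; zero; suc; punchIn) renaming (_≟_ to _≟ᶠ_)
open import Data.Fin.Properties using (punchInᵢ≢i; any?)
open import Data.Bool using (Bool; true; false; not; _∧_; if_then_else_)
open import Data.Bool.Properties
  using (not-involutive; not-injective; ¬-not; ∧-conicalˡ; ∧-conicalʳ) renaming (_≟_ to _≟ᵇ_)
open import Data.Product using (Σ; ∃; _×_; _,_; proj₁; proj₂; uncurry)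
open import Data.Product.Properties using (≡-dec)
open import Data.Sum using (_⊎_; inj₁; inj₂)
open import Data.Empty using (⊥; ⊥-elim)
open import Data.List as List using (List; []; _∷_; cartesianProduct)
open import Data.List.Membership.Propositional using (_∈_)
open import Data.List.Membership.Propositional.Properties using (∈-cartesianProduct⁺; ∈-allFin)
open import Data.List.Relation.Unary.Any using (here; there)
open import Data.Vec using (count; tabulate)
open import Function using (_∘_)
open import Relation.Nullary using (¬_; Dec; yes; no; does; contradiction)
open import Relation.Nullary.Decidable using (dec-true; dec-false; _×-dec_; _⊎-dec_)
open import Relation.Binary.Definitions using (DecidableEquality)
open import Relation.Binary.PropositionalEquality
open import Algebra.Properties.Semiring.Sum +-*-semiring
  using (sum; sum-syntax; sum-cong-≗; sum-remove; sum-replicate-zero; ∑-comm; ∑-distrib-+;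
         *-distribˡ-sum; *-distribʳ-sum)
open import Data.Nat.Tactic.RingSolver using (solve-∀)

ι : Bool → ℕ
ι true  = 1
ι false = 0

-- Boolean equality.  With a literal on the left it computes:
-- (true == γ) = γ and (false == γ) = not γ.
_==_ : Bool → Bool → Bool
true  == γ = γ
false == γ = not γ

==-refl : ∀ β → (β == β) ≡ true
==-refl true  = refl
==-refl false = refl

==-sound : ∀ {β γ} → (β == γ) ≡ true → β ≡ γ
==-sound {true}  {true}  _ = refl
==-sound {false} {false} _ = refl

==-≢ : ∀ {β γ} → β ≢ γ → (β == γ) ≡ false
==-≢ {true}  {true}  β≢γ = contradiction refl β≢γ
==-≢ {true}  {false} _   = refl
==-≢ {false} {true}  _   = refl
==-≢ {false} {false} β≢γ = contradiction refl β≢γ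

==-false : ∀ {β γ} → (β == γ) ≡ false → β ≢ γ
==-false {β} eq refl with () ← trans (sym eq) (==-refl β)

bool-third : ∀ {a b c : Bool} → a ≢ b → a ≢ c → b ≡ c
bool-third a≢b a≢c = not-injective (trans (sym (¬-not a≢b)) (¬-not a≢c))

update : ∀ {A : Set} → DecidableEquality A → (A → Bool) → A → Bool → A → Bool
update _≟_ f a b x = if does (x ≟ a) then b else f x

update-here : ∀ {A : Set} (_≟_ : DecidableEquality A) f a b → update _≟_ f a b a ≡ b
update-here _≟_ f a b rewrite dec-true (a ≟ a) refl = refl

update-there : ∀ {A : Set} (_≟_ : DecidableEquality A) f {a} b {x} → x ≢ a → update _≟_ f a b x ≡ f x
update-there _≟_ f {a} b {x} x≢a rewrite dec-false (x ≟ a) x≢a = refl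

∑-mono-≤ : ∀ {m} {f g : Fin m → ℕ} → (∀ i → f i ≤ g i) → sum f ≤ sum g
∑-mono-≤ {zero}  _   = z≤n
∑-mono-≤ {suc m} f≤g = +-mono-≤ (f≤g zero) (∑-mono-≤ (f≤g ∘ suc))

∑-mono-< : ∀ {m} {f g : Fin m → ℕ} → (∀ i → f i ≤ g i) → ∀ j → f j < g j → sum f < sum g
∑-mono-< {suc m} f≤g zero    fj<gj = +-mono-<-≤ fj<gj (∑-mono-≤ (f≤g ∘ suc))
∑-mono-< {suc m} f≤g (suc j) fj<gj = +-mono-≤-< (f≤g zero) (∑-mono-< (f≤g ∘ suc) j fj<gj)

∑-update : ∀ {m} {f g : Fin m → ℕ} i → (∀ j → j ≢ i → f j ≡ g j) → sum f + g i ≡ sum g + f i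
∑-update {suc m} {f} {g} i agree = begin
  sum f + g i                     ≡⟨ cong (_+ g i) (sum-remove f) ⟩
  f i + sum (f ∘ punchIn i) + g i ≡⟨ cong (λ s → f i + s + g i) rest ⟩
  f i + sum (g ∘ punchIn i) + g i ≡⟨ swap-ends (f i) _ (g i) ⟩
  g i + sum (g ∘ punchIn i) + f i ≡⟨ cong (_+ f i) (sum-remove g) ⟨
  sum g + f i                     ∎
  where
  open ≡-Reasoning
  rest : sum (f ∘ punchIn i) ≡ sum (g ∘ punchIn i)
  rest = sum-cong-≗ (λ j → agree (punchIn i j) (punchInᵢ≢i i j))
  swap-ends : ∀ a s b → a + s + b ≡ b + s + a
  swap-ends = solve-∀

∑-ones : ∀ m → ∑[ i < m ] 1 ≡ m
∑-ones zero    = refl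
∑-ones (suc m) = cong suc (∑-ones m)

card : ∀ {m} → (Fin m → Bool) → ℕ
card S = sum (ι ∘ S)

sumOver : ∀ {m} → (Fin m → Bool) → (Fin m → ℕ) → ℕ
sumOver S f = sum (λ i → ι (S i) * f i)

card-≤ : ∀ {m} (S : Fin m → Bool) → card S ≤ m
card-≤ {m} S = ≤-trans (∑-mono-≤ (λ i → ι≤1 (S i))) (≤-reflexive (∑-ones m))
  where
  ι≤1 : ∀ b → ι b ≤ 1
  ι≤1 true  = ≤-refl
  ι≤1 false = z≤n

sumOver-const : ∀ {m} (S : Fin m → Bool) k → sumOver S (λ _ → k) ≡ card S * k
sumOver-const S k = sym (*-distribʳ-sum k (ι ∘ S))

sumOver-mono : ∀ {m} (S : Fin m → Bool) {f g : Fin m → ℕ} →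
  (∀ i → S i ≡ true → f i ≤ g i) → sumOver S f ≤ sumOver S g
sumOver-mono S f≤g = ∑-mono-≤ scaled
  where
  scaled : ∀ i → ι (S i) * _ ≤ ι (S i) * _
  scaled i with S i in Si
  ... | true  = *-monoʳ-≤ 1 (f≤g i Si)
  ... | false = z≤n

sumOver-mono-< : ∀ {m} (S : Fin m → Bool) {f g : Fin m → ℕ} →
  (∀ i → S i ≡ true → f i ≤ g i) → ∀ j → S j ≡ true → f j < g j → sumOver S f < sumOver S g
sumOver-mono-< S {f} {g} f≤g j Sj fj<gj = ∑-mono-< scaled j strict
  where
  scaled : ∀ i → ι (S i) * f i ≤ ι (S i) * g i
  scaled i with S i in Si
  ... | true  = *-monoʳ-≤ 1 (f≤g i Si)
  ... | false = z≤n
  strict : ι (S j) * f j < ι (S j) * g j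
  strict rewrite Sj | *-identityˡ (f j) | *-identityˡ (g j) = fj<gj

ι-and-mono : ∀ {a b a′ b′} → (a ≡ true → b ≡ true → a′ ≡ true × b′ ≡ true) →
  ι a * ι b ≤ ι a′ * ι b′
ι-and-mono {false}        _ = z≤n
ι-and-mono {true} {false} _ = z≤n
ι-and-mono {true} {true}  both with both refl refl
... | refl , refl = ≤-refl

insert : ∀ {m} → (Fin m → Bool) → Fin m → Fin m → Bool
insert R w = update _≟ᶠ_ R w true

insert-⊇ : ∀ {m} (R : Fin m → Bool) w {v} → R v ≡ true → insert R w v ≡ true
insert-⊇ R w {v} Rv with v ≟ᶠ w
... | yes _ = refl
... | no _  = Rv

insert-outside : ∀ {m} (R : Fin m → Bool) w {v} → insert R w v ≡ false → R v ≡ false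
insert-outside R w {v} outside with v ≟ᶠ w
... | no _ = outside

card-insert : ∀ {m} (R : Fin m → Bool) w → R w ≡ false → card (insert R w) ≡ suc (card R)
card-insert R w Rw = begin
  card (insert R w)           ≡⟨ +-identityʳ _ ⟨
  card (insert R w) + 0       ≡⟨ cong (λ b → card (insert R w) + ι b) Rw ⟨
  card (insert R w) + ι (R w) ≡⟨ ∑-update w (λ v v≢w → cong ι (update-there _≟ᶠ_ R true v≢w)) ⟩
  card R + ι (insert R w w)   ≡⟨ cong (λ b → card R + ι b) (update-here _≟ᶠ_ R w true) ⟩
  card R + 1                  ≡⟨ +-comm (card R) 1 ⟩
  suc (card R)                ∎
  where open ≡-Reasoning

with-units : ∀ {L′ L x x′ y y′ : ℕ} → x ≡ x′ → y ≡ y′ → L′ + x′ ≡ L + y′ → L′ + x ≡ L + y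
with-units refl refl eq = eq

fits-with-units : ∀ {L C x x′ y y′ : ℕ} → x ≡ x′ → y ≡ y′ → L + x′ ≤ C + y′ → L + x ≤ C + y
fits-with-units refl refl le = le

-- Composing two moves through an intermediate stage: what the first move gains (b) the
-- second loses, and what the first loses (b′) the second gains.
cancel-through : ∀ {L L₁ L₂ a a′ b b′ d d′ : ℕ} →
  L₁ + (a + b′) ≡ L + (a′ + b) → L₂ + (b + d′) ≡ L₁ + (b′ + d) → L₂ + (a + d′) ≡ L + (a′ + d)
cancel-through {L} {L₁} {L₂} {a} {a′} {b} {b′} {d} {d′} first second =
  +-cancelʳ-≡ (L₁ + b + b′) _ _ (begin
    L₂ + (a + d′) + (L₁ + b + b′)     ≡⟨ regroup₁ L₂ a d′ L₁ b b′ ⟩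
    (L₂ + (b + d′)) + (L₁ + (a + b′)) ≡⟨ cong₂ _+_ second first ⟩
    (L₁ + (b′ + d)) + (L + (a′ + b))  ≡⟨ regroup₂ L₁ b′ d L a′ b ⟩
    L + (a′ + d) + (L₁ + b + b′)      ∎)
  where
  open ≡-Reasoning
  regroup₁ : ∀ L₂ a d′ L₁ b b′ → L₂ + (a + d′) + (L₁ + b + b′) ≡ (L₂ + (b + d′)) + (L₁ + (a + b′))
  regroup₁ = solve-∀
  regroup₂ : ∀ L₁ b′ d L a′ b → (L₁ + (b′ + d)) + (L + (a′ + b)) ≡ L + (a′ + d) + (L₁ + b + b′)
  regroup₂ = solve-∀

one-over : ∀ {x y} → x ≤ suc y → x + 0 ≤ y + 1
one-over {x} {y} le rewrite +-identityʳ x | +-comm y 1 = le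

one-under : ∀ {x y} → x < y → x + 1 ≤ y + 0
one-under {x} {y} lt rewrite +-identityʳ y | +-comm x 1 = lt

unit-move-fits : ∀ {L cap : Bool → ℕ} from → L from ≤ suc (cap from) → L (not from) < cap (not from) →
  ∀ γ → L γ + ι (γ == not from) ≤ cap γ + ι (γ == from)
unit-move-fits true  over _     true  = one-over over
unit-move-fits true  _    under false = one-under under
unit-move-fits false _    under true  = one-under under
unit-move-fits false over _     false = one-over over

add-unit-fits : ∀ {L cap : Bool → ℕ} γ → L γ < cap γ → (∀ β → L β ≤ cap β) → ∀ β → L β + ι (β == γ) ≤ cap β
add-unit-fits {L} {cap} true  room _     true  = subst (_≤ cap true) (+-comm 1 (L true)) room
add-unit-fits {L} {cap} true  _    valid false = subst (_≤ cap false) (sym (+-identityʳ _)) (valid false)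
add-unit-fits {L} {cap} false _    valid true  = subst (_≤ cap true) (sym (+-identityʳ _)) (valid true)
add-unit-fits {L} {cap} false room _     false = subst (_≤ cap false) (+-comm 1 (L false)) room

one-below : ∀ {x y a b} → x + y < a + b → x < a ⊎ y < b
one-below {x} {y} {a} {b} lt with x <? a | y <? b
... | yes x<a | _       = inj₁ x<a
... | no _    | yes y<b = inj₂ y<b
... | no x≮a  | no y≮b  = contradiction lt (≤⇒≯ (+-mono-≤ (≮⇒≥ x≮a) (≮⇒≥ y≮b)))

-- The vertex type t decides which side a vertex looks at: t a = true means that a counts
-- its in-edges, t a = false its out-edges.

module Viewpoint {n : ℕ} (t : Fin n → Bool) where

  Pair : Set
  Pair = Fin n × Fin n

  _≟ᵖ_ : DecidableEquality Pair
  _≟ᵖ_ = ≡-dec _≟ᶠ_ _≟ᶠ_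

  edge : Fin n → Fin n → Pair
  edge a b = if t a then (b , a) else (a , b)

  edge-in : ∀ {a} b → t a ≡ true → edge a b ≡ (b , a)
  edge-in b ta rewrite ta = refl

  edge-out : ∀ {a} b → t a ≡ false → edge a b ≡ (a , b)
  edge-out b ta rewrite ta = refl

  edge-cases : ∀ {z u a b} → edge z u ≡ edge a b →
    (z ≡ a × u ≡ b) ⊎ (z ≡ b × u ≡ a × t z ≢ t a)
  edge-cases {z} {u} {a} {b} eq with t z | t a
  ... | true  | true  = inj₁ (cong proj₂ eq , cong proj₁ eq)
  ... | true  | false = inj₂ (cong proj₂ eq , cong proj₁ eq , λ ())
  ... | false | true  = inj₂ (cong proj₁ eq , cong proj₂ eq , λ ())
  ... | false | false = inj₁ (cong proj₁ eq , cong proj₂ eq)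

  edge-injective : ∀ {z u u′} → edge z u ≡ edge z u′ → u ≡ u′
  edge-injective eq with edge-cases eq
  ... | inj₁ (_ , u≡u′)      = u≡u′
  ... | inj₂ (_ , _ , tz≢tz) = contradiction refl tz≢tz

  edge-shared : ∀ {a b} → t a ≢ t b → edge b a ≡ edge a b
  edge-shared {a} {b} ta≢tb with t a | t b
  ... | true  | true  = contradiction refl ta≢tb
  ... | true  | false = refl
  ... | false | true  = refl
  ... | false | false = contradiction refl ta≢tb

  seen : (Pair → Bool) → Fin n → ℕ
  seen f z = ∑[ u < n ] ι (f (edge z u))

  seen-mono : ∀ {f g : Pair → Bool} z → (∀ Q → f Q ≡ true → g Q ≡ true) → seen f z ≤ seen g z
  seen-mono {f} {g} z f⊆g = ∑-mono-≤ (λ u → ι-mono (f⊆g (edge z u)))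
    where
    ι-mono : ∀ {a b} → (a ≡ true → b ≡ true) → ι a ≤ ι b
    ι-mono {false} _    = z≤n
    ι-mono {true}  a⇒b rewrite a⇒b refl = ≤-refl

  seen-update : ∀ {f g : Pair → Bool} {q z u₀} → (∀ Q → Q ≢ q → f Q ≡ g Q) →
    edge z u₀ ≡ q → seen f z + ι (g q) ≡ seen g z + ι (f q)
  seen-update {f} {g} {q} {z} {u₀} agree refl =
    ∑-update u₀ (λ u u≢u₀ → cong ι (agree (edge z u) (u≢u₀ ∘ edge-injective)))

  seen-unchanged : ∀ {f g : Pair → Bool} {q z} → (∀ Q → Q ≢ q → f Q ≡ g Q) →
    (∀ u → edge z u ≢ q) → seen f z ≡ seen g z
  seen-unchanged agree unseen = sum-cong-≗ (λ u → cong ι (agree _ (unseen u)))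

  double-counting : ∀ (S S′ : Fin n → Bool) (f : Pair → Bool) →
    (∀ v u → S v ≡ true → f (edge v u) ≡ true → S′ u ≡ true × edge u v ≡ edge v u) →
    sumOver S (seen f) ≤ sumOver S′ (seen f)
  double-counting S S′ f closed = begin
    sumOver S (seen f)
      ≡⟨ sum-cong-≗ (λ v → *-distribˡ-sum (ι (S v)) (λ u → ι (f (edge v u)))) ⟩
    ∑[ v < n ] (∑[ u < n ] (ι (S v) * ι (f (edge v u))))
      ≤⟨ ∑-mono-≤ (λ v → ∑-mono-≤ (λ u → ι-and-mono (pointwise v u))) ⟩
    ∑[ v < n ] (∑[ u < n ] (ι (S′ u) * ι (f (edge u v))))
      ≡⟨ ∑-comm (λ v u → ι (S′ u) * ι (f (edge u v))) ⟩
    ∑[ u < n ] (∑[ v < n ] (ι (S′ u) * ι (f (edge u v))))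
      ≡⟨ sum-cong-≗ (λ u → *-distribˡ-sum (ι (S′ u)) (λ v → ι (f (edge u v)))) ⟨
    sumOver S′ (seen f) ∎
    where
    open ≤-Reasoning
    pointwise : ∀ v u → S v ≡ true → f (edge v u) ≡ true → S′ u ≡ true × f (edge u v) ≡ true
    pointwise v u Sv fvu with closed v u Sv fvu
    ... | S′u , shared = S′u , trans (cong f shared) fvu

-- A graph and a colouring are both boolean functions on pairs; only the colours of edges
-- matter.

module Colourings {n : ℕ} (t : Fin n → Bool) (capacity : Bool → ℕ) where

  open Viewpoint t public

  Graph Colouring : Set
  Graph     = Pair → Bool
  Colouring = Pair → Bool

  _[_≔_] : (Pair → Bool) → Pair → Bool → Pair → Bool
  f [ q ≔ b ] = update _≟ᵖ_ f q b

  flip : Colouring → Pair → Colouring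
  flip c q = c [ q ≔ not (c q) ]

  colourClass : Graph → Colouring → Bool → Graph
  colourClass E c β Q = E Q ∧ (β == c Q)

  load : Graph → Colouring → Fin n → Bool → ℕ
  load E c z β = seen (colourClass E c β) z

  degree : Graph → Fin n → ℕ
  degree E z = seen E z

  load-split : ∀ E c z γ → load E c z γ + load E c z (not γ) ≡ degree E z
  load-split E c z true  =
    trans (sym (∑-distrib-+ (λ u → ι (colourClass E c true (edge z u))) (λ u → ι (colourClass E c false (edge z u)))))
          (sum-cong-≗ (λ u → classes (E (edge z u)) (c (edge z u))))
    where
    classes : ∀ e x → ι (e ∧ x) + ι (e ∧ not x) ≡ ι e
    classes false _     = refl
    classes true  true  = refl
    classes true  false = refl
  load-split E c z false = trans (+-comm (load E c z false) (load E c z true)) (load-split E c z true)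

  ValidAt : Graph → Colouring → Fin n → Set
  ValidAt E c z = ∀ β → load E c z β ≤ capacity β

  Valid : Graph → Colouring → Set
  Valid E c = ∀ z → ValidAt E c z

  capacity-total : ∀ γ → capacity γ + capacity (not γ) ≡ capacity true + capacity false
  capacity-total true  = refl
  capacity-total false = +-comm (capacity false) (capacity true)

  spare-when-over : ∀ E c z γ → degree E z ≤ capacity true + capacity false →
    load E c z γ ≡ suc (capacity γ) → load E c z (not γ) < capacity (not γ)
  spare-when-over E c z γ bounded over = +-cancelˡ-≤ (capacity γ) _ _ (begin
    capacity γ + suc (load E c z (not γ)) ≡⟨ +-suc (capacity γ) _ ⟩
    suc (capacity γ) + load E c z (not γ) ≡⟨ cong (_+ load E c z (not γ)) over ⟨
    load E c z γ + load E c z (not γ)     ≡⟨ load-split E c z γ ⟩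
    degree E z                            ≤⟨ bounded ⟩
    capacity true + capacity false        ≡⟨ capacity-total γ ⟨
    capacity γ + capacity (not γ)         ∎)
    where open ≤-Reasoning

  unit : Fin n → Bool → Fin n → Bool → ℕ
  unit a γ z β = if does (z ≟ᶠ a) then ι (β == γ) else 0

  _⊕_ : (Fin n → Bool → ℕ) → (Fin n → Bool → ℕ) → Fin n → Bool → ℕ
  (f ⊕ g) z β = f z β + g z β

  Moves : Graph → Colouring → Colouring → (lost gained : Fin n → Bool → ℕ) → Set
  Moves E c c′ lost gained = ∀ z β → load E c′ z β + lost z β ≡ load E c z β + gained z β

  moves-chain : ∀ {E c c₁ c₂ a a′ b b′ d d′} →
    Moves E c c₁ (a ⊕ b′) (a′ ⊕ b) → Moves E c₁ c₂ (b ⊕ d′) (b′ ⊕ d) → Moves E c c₂ (a ⊕ d′) (a′ ⊕ d)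
  moves-chain {E} {c} {c₁} {c₂} {a} {a′} {b} {b′} {d} {d′} first second z β =
    cancel-through {load E c z β} {load E c₁ z β} {load E c₂ z β}
                   {a z β} {a′ z β} {b z β} {b′ z β} {d z β} {d′ z β} (first z β) (second z β)

  moves-chain-end : ∀ {E c c₁ c₂ a a′ b b′} →
    Moves E c c₁ (a ⊕ b′) (a′ ⊕ b) → Moves E c₁ c₂ b b′ → Moves E c c₂ a a′
  moves-chain-end {E} {c} {c₁} {c₂} {a} {a′} {b} {b′} first second z β =
    with-units (sym (+-identityʳ (a z β))) (sym (+-identityʳ (a′ z β)))
      (cancel-through {load E c z β} {load E c₁ z β} {load E c₂ z β}
                      {a z β} {a′ z β} {b z β} {b′ z β} {0} {0}
                      (first z β) (with-units (+-identityʳ (b z β)) (+-identityʳ (b′ z β)) (second z β)))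

  Fits : Graph → Colouring → (lost gained : Fin n → Bool → ℕ) → Set
  Fits E c lost gained = ∀ z γ → load E c z γ + gained z γ ≤ capacity γ + lost z γ

  valid-after : ∀ E c c′ {lost gained} → Moves E c c′ lost gained → Fits E c lost gained → Valid E c′
  valid-after E c c′ {lost} moved fits z γ =
    +-cancelʳ-≤ (lost z γ) _ _ (≤-trans (≤-reflexive (moved z γ)) (fits z γ))

  module _ (E : Graph) where

    flip-agrees : ∀ c q β Q → Q ≢ q → colourClass E (flip c q) β Q ≡ colourClass E c β Q
    flip-agrees c q β Q Q≢q = cong (λ x → E Q ∧ (β == x)) (update-there _≟ᵖ_ c (not (c q)) Q≢q)

    flip-at-viewer : ∀ c {q z u₀} β → E q ≡ true → edge z u₀ ≡ q →
      load E (flip c q) z β + ι (β == c q) ≡ load E c z β + ι (β == not (c q))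
    flip-at-viewer c {q} {z} β isEdge sees = begin
      load E (flip c q) z β + ι (β == c q)
        ≡⟨ cong (λ e → load E (flip c q) z β + ι (e ∧ (β == c q))) isEdge ⟨
      load E (flip c q) z β + ι (colourClass E c β q)
        ≡⟨ seen-update (flip-agrees c q β) sees ⟩
      load E c z β + ι (colourClass E (flip c q) β q)
        ≡⟨ cong (λ e → load E c z β + ι (e ∧ (β == flip c q q))) isEdge ⟩
      load E c z β + ι (β == flip c q q)
        ≡⟨ cong (λ x → load E c z β + ι (β == x)) (update-here _≟ᵖ_ c q (not (c q))) ⟩
      load E c z β + ι (β == not (c q)) ∎
      where open ≡-Reasoning

    flip-elsewhere : ∀ c {q z} β → (∀ u → edge z u ≢ q) → load E (flip c q) z β ≡ load E c z β
    flip-elsewhere c {q} β unseen = seen-unchanged (flip-agrees c q β) unseen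

    flip-one-viewer : ∀ c {a b} → E (edge a b) ≡ true → t a ≡ t b →
      let γ = c (edge a b) in Moves E c (flip c (edge a b)) (unit a γ) (unit a (not γ))
    flip-one-viewer c {a} {b} isEdge ta≡tb z β with z ≟ᶠ a
    ... | yes refl = flip-at-viewer c β isEdge refl
    ... | no z≢a   = cong (_+ 0) (flip-elsewhere c β unseen)
      where
      unseen : ∀ u → edge z u ≢ edge a b
      unseen u eq with edge-cases eq
      ... | inj₁ (z≡a , _)          = z≢a z≡a
      ... | inj₂ (refl , _ , tb≢ta) = tb≢ta (sym ta≡tb)

    flip-two-viewers : ∀ c {a b} → E (edge a b) ≡ true → t a ≢ t b →
      let γ = c (edge a b) in
      Moves E c (flip c (edge a b)) (unit a γ ⊕ unit b γ) (unit a (not γ) ⊕ unit b (not γ))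
    flip-two-viewers c {a} {b} isEdge ta≢tb z β with z ≟ᶠ a | z ≟ᶠ b
    ... | yes refl | yes refl = contradiction refl ta≢tb
    ... | yes refl | no _ =
      with-units (+-identityʳ (ι (β == c (edge a b)))) (+-identityʳ (ι (β == not (c (edge a b)))))
                 (flip-at-viewer c β isEdge refl)
    ... | no _ | yes refl = flip-at-viewer c β isEdge (edge-shared ta≢tb)
    ... | no z≢a | no z≢b = cong (_+ 0) (flip-elsewhere c β unseen)
      where
      unseen : ∀ u → edge z u ≢ edge a b
      unseen u eq with edge-cases eq
      ... | inj₁ (z≡a , _)     = z≢a z≡a
      ... | inj₂ (z≡b , _ , _) = z≢b z≡b

  -- Vertices on y's side pass units on in colour β, the others in
  -- colour not β (ρ v).  An arc v → w is an edge seen by v in colour ρ v: flipping it moves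
  -- v's unit to w.  We grow a set R of explored vertices, each of which can receive y's unit
  -- by flipping edges inside R only; all of R except y is saturated in its colour ρ.

  module Repair (E : Graph) (c : Colouring) (y : Fin n) (β : Bool)
      (valid-elsewhere : ∀ z → z ≢ y → ValidAt E c z)
      (overloaded : load E c y β ≡ suc (capacity β))
      (spare : load E c y (not β) < capacity (not β)) where

    ρ : Fin n → Bool
    ρ v = if t v == t y then β else not β

    ρ-same : ∀ {v} → t v ≡ t y → ρ v ≡ β
    ρ-same tv≡ty rewrite tv≡ty | ==-refl (t y) = refl

    ρ-other : ∀ {v} → t v ≢ t y → ρ v ≡ not β
    ρ-other tv≢ty rewrite ==-≢ tv≢ty = refl

    ρ-across : ∀ {a b} → t a ≢ t b → ρ b ≡ not (ρ a)
    ρ-across {a} {b} ta≢tb with t a ≟ᵇ t y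
    ... | yes ta≡ty = trans (ρ-other (λ tb≡ty → ta≢tb (trans ta≡ty (sym tb≡ty))))
                            (cong not (sym (ρ-same ta≡ty)))
    ... | no ta≢ty  = trans (ρ-same (bool-third ta≢tb ta≢ty))
                            (trans (sym (not-involutive β)) (cong not (sym (ρ-other ta≢ty))))

    Arc : Colouring → Fin n → Fin n → Set
    Arc c′ a b = E (edge a b) ≡ true × c′ (edge a b) ≡ ρ a

    -- c′ has moved y's excess unit to v: y lost a unit of ρ y, v gained a unit of ρ v.
    Transfer : Colouring → Fin n → Set
    Transfer c′ v = Moves E c c′ (unit y (ρ y) ⊕ unit v (not (ρ v))) (unit y (not (ρ y)) ⊕ unit v (ρ v))

    Untouched : (Fin n → Bool) → Colouring → Set
    Untouched R c′ = ∀ u w → R w ≡ false ⊎ t u ≡ t w → c′ (edge u w) ≡ c (edge u w)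

    Reached : (Fin n → Bool) → Fin n → Set
    Reached R v = Σ Colouring λ c′ → Transfer c′ v × Untouched R c′

    record Explored (R : Fin n → Bool) : Set where
      field
        root      : R y ≡ true
        saturated : ∀ v → R v ≡ true → capacity (ρ v) ≤ load E c v (ρ v)
        reached   : ∀ v → R v ≡ true → Reached R v

    Closed : (Fin n → Bool) → Set
    Closed R = ∀ v w → R v ≡ true → Arc c v w → t w ≢ t v × R w ≡ true

    flip-arc : ∀ c′ {v w} → Arc c′ v w → t v ≢ t w →
      Moves E c′ (flip c′ (edge v w)) (unit v (ρ v) ⊕ unit w (not (ρ w))) (unit v (not (ρ v)) ⊕ unit w (ρ w))
    flip-arc c′ {v} {w} (isEdge , colour) tv≢tw =
      subst₂ (Moves E c′ (flip c′ (edge v w)))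
        (cong₂ _⊕_ (cong (unit v) colour) (cong (unit w) lost-at-w))
        (cong₂ _⊕_ (cong (unit v ∘ not) colour) (cong (unit w) gained-at-w))
        (flip-two-viewers E c′ isEdge tv≢tw)
      where
      lost-at-w : c′ (edge v w) ≡ not (ρ w)
      lost-at-w = trans colour (ρ-across (λ tw≡tv → tv≢tw (sym tw≡tv)))
      gained-at-w : not (c′ (edge v w)) ≡ ρ w
      gained-at-w = trans (cong not lost-at-w) (not-involutive (ρ w))

    flip-blind-arc : ∀ c′ {v w} → Arc c′ v w → t v ≡ t w →
      Moves E c′ (flip c′ (edge v w)) (unit v (ρ v)) (unit v (not (ρ v)))
    flip-blind-arc c′ {v} {w} (isEdge , colour) tv≡tw =
      subst₂ (Moves E c′ (flip c′ (edge v w)))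
        (cong (unit v) colour) (cong (unit v ∘ not) colour)
        (flip-one-viewer E c′ isEdge tv≡tw)

    transfer-onward : ∀ {v w} c₁ c₂ → Transfer c₁ v →
      Moves E c₁ c₂ (unit v (ρ v) ⊕ unit w (not (ρ w))) (unit v (not (ρ v)) ⊕ unit w (ρ w)) → Transfer c₂ w
    transfer-onward {v} {w} c₁ c₂ =
      moves-chain {E} {c} {c₁} {c₂} {a = unit y (ρ y)} {unit y (not (ρ y))} {unit v (ρ v)} {unit v (not (ρ v))}
                  {unit w (ρ w)} {unit w (not (ρ w))}

    transfer-release : ∀ {v} c₁ c₂ → Transfer c₁ v →
      Moves E c₁ c₂ (unit v (ρ v)) (unit v (not (ρ v))) → Moves E c c₂ (unit y (ρ y)) (unit y (not (ρ y)))
    transfer-release {v} c₁ c₂ =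
      moves-chain-end {E} {c} {c₁} {c₂} {a = unit y (ρ y)} {unit y (not (ρ y))} {unit v (ρ v)} {unit v (not (ρ v))}

    fits-at-y : ∀ γ → load E c y γ + ι (γ == not (ρ y)) ≤ capacity γ + ι (γ == ρ y)
    fits-at-y γ rewrite ρ-same {y} refl = unit-move-fits β (≤-reflexive overloaded) spare γ

    fits-at-room : ∀ {w} → w ≢ y → load E c w (ρ w) < capacity (ρ w) →
      ∀ γ → load E c w γ + ι (γ == ρ w) ≤ capacity γ + ι (γ == not (ρ w))
    fits-at-room {w} w≢y room γ =
      subst (λ x → load E c w γ + ι (γ == x) ≤ capacity γ + ι (γ == not (ρ w))) (not-involutive (ρ w))
        (unit-move-fits (not (ρ w)) (m≤n⇒m≤1+n (valid-elsewhere w w≢y (not (ρ w))))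
           (subst (λ x → load E c w x < capacity x) (sym (not-involutive (ρ w))) room) γ)

    fits-released : Fits E c (unit y (ρ y)) (unit y (not (ρ y)))
    fits-released z γ with z ≟ᶠ y
    ... | yes refl = fits-at-y γ
    ... | no z≢y   = +-monoˡ-≤ 0 (valid-elsewhere z z≢y γ)

    fits-transferred : ∀ {w} → w ≢ y → load E c w (ρ w) < capacity (ρ w) →
      Fits E c (unit y (ρ y) ⊕ unit w (not (ρ w))) (unit y (not (ρ y)) ⊕ unit w (ρ w))
    fits-transferred {w} w≢y room z γ with z ≟ᶠ y | z ≟ᶠ w
    ... | yes refl | yes refl = contradiction refl w≢y
    ... | yes refl | no _     =
      fits-with-units (+-identityʳ (ι (γ == not (ρ z)))) (+-identityʳ (ι (γ == ρ z))) (fits-at-y γ)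
    ... | no _     | yes refl = fits-at-room w≢y room γ
    ... | no z≢y   | no _     = +-monoˡ-≤ 0 (valid-elsewhere z z≢y γ)

    -- The arcs of Near carry colour β into Far and those of Far carry
    -- colour not β into Near, so by double counting
    --   |Near|·cap β < (β-load of Near) ≤ (β-load of Far) ≤ |Far|·cap β       (y is overloaded)
    --   |Far|·cap ¬β ≤ (¬β-load of Far) ≤ (¬β-load of Near) < |Near|·cap ¬β   (y has room).
    module Counting {R : Fin n → Bool} (explored : Explored R) (closed : Closed R) where

      open Explored explored

      Near Far : Fin n → Bool
      Near v = R v ∧ (t v == t y)
      Far  v = R v ∧ not (t v == t y)

      in-Near : ∀ {v} → Near v ≡ true → R v ≡ true × t v ≡ t y
      in-Near Nv = ∧-conicalˡ _ _ Nv , ==-sound (∧-conicalʳ _ _ Nv)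

      in-Far : ∀ {v} → Far v ≡ true → R v ≡ true × t v ≢ t y
      in-Far Fv = ∧-conicalˡ _ _ Fv , ==-false (not-injective (∧-conicalʳ _ _ Fv))

      to-Near : ∀ {u} → R u ≡ true → t u ≡ t y → Near u ≡ true
      to-Near Ru tu≡ty rewrite Ru | tu≡ty = ==-refl (t y)

      to-Far : ∀ {u} → R u ≡ true → t u ≢ t y → Far u ≡ true
      to-Far Ru tu≢ty rewrite Ru | ==-≢ tu≢ty = refl

      arc-of : ∀ {v u γ} → ρ v ≡ γ → colourClass E c γ (edge v u) ≡ true → Arc c v u
      arc-of ρv≡γ inClass =
        ∧-conicalˡ _ _ inClass , trans (sym (==-sound (∧-conicalʳ _ _ inClass))) (sym ρv≡γ)

      Near→Far : ∀ v u → Near v ≡ true → colourClass E c β (edge v u) ≡ true →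
        Far u ≡ true × edge u v ≡ edge v u
      Near→Far v u Nv inClass with in-Near Nv
      ... | Rv , tv≡ty with closed v u Rv (arc-of (ρ-same tv≡ty) inClass)
      ... | tu≢tv , Ru =
        to-Far Ru (λ tu≡ty → tu≢tv (trans tu≡ty (sym tv≡ty))) , edge-shared (λ tv≡tu → tu≢tv (sym tv≡tu))

      Far→Near : ∀ v u → Far v ≡ true → colourClass E c (not β) (edge v u) ≡ true →
        Near u ≡ true × edge u v ≡ edge v u
      Far→Near v u Fv inClass with in-Far Fv
      ... | Rv , tv≢ty with closed v u Rv (arc-of (ρ-other tv≢ty) inClass)
      ... | tu≢tv , Ru =
        to-Near Ru (bool-third (λ tv≡tu → tu≢tv (sym tv≡tu)) tv≢ty) , edge-shared (λ tv≡tu → tu≢tv (sym tv≡tu))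

      Near-over : card Near * capacity β < sumOver Near (λ v → load E c v β)
      Near-over = subst (_< sumOver Near (λ v → load E c v β)) (sumOver-const Near (capacity β))
        (sumOver-mono-< Near {λ _ → capacity β} saturated-β y (to-Near root refl) (≤-reflexive (sym overloaded)))
        where
        saturated-β : ∀ v → Near v ≡ true → capacity β ≤ load E c v β
        saturated-β v Nv = subst (λ γ → capacity γ ≤ load E c v γ) (ρ-same (proj₂ (in-Near Nv)))
                             (saturated v (proj₁ (in-Near Nv)))

      Far-under : sumOver Far (λ v → load E c v β) ≤ card Far * capacity β
      Far-under = subst (sumOver Far (λ v → load E c v β) ≤_) (sumOver-const Far (capacity β))
        (sumOver-mono Far {g = λ _ → capacity β} (λ v Fv → valid-elsewhere v (λ v≡y → proj₂ (in-Far Fv) (cong t v≡y)) β))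

      Far-over : card Far * capacity (not β) ≤ sumOver Far (λ v → load E c v (not β))
      Far-over = subst (_≤ sumOver Far (λ v → load E c v (not β))) (sumOver-const Far (capacity (not β)))
                   (sumOver-mono Far {λ _ → capacity (not β)} saturated-not-β)
        where
        saturated-not-β : ∀ v → Far v ≡ true → capacity (not β) ≤ load E c v (not β)
        saturated-not-β v Fv = subst (λ γ → capacity γ ≤ load E c v γ) (ρ-other (proj₂ (in-Far Fv)))
                                 (saturated v (proj₁ (in-Far Fv)))

      Near-under : sumOver Near (λ v → load E c v (not β)) < card Near * capacity (not β)
      Near-under = subst (sumOver Near (λ v → load E c v (not β)) <_) (sumOver-const Near (capacity (not β)))
        (sumOver-mono-< Near {g = λ _ → capacity (not β)} within y (to-Near root refl) spare)
        where
        within : ∀ v → Near v ≡ true → load E c v (not β) ≤ capacity (not β)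
        within v _ with v ≟ᶠ y
        ... | yes refl = <⇒≤ spare
        ... | no v≢y   = valid-elsewhere v v≢y (not β)

      impossible : ⊥
      impossible = <-asym Near<Far Far<Near
        where
        Near<Far : card Near < card Far
        Near<Far = *-cancelʳ-< (capacity β) (card Near) (card Far)
          (<-≤-trans Near-over (≤-trans (double-counting Near Far (colourClass E c β) Near→Far) Far-under))
        Far<Near : card Far < card Near
        Far<Near = *-cancelʳ-< (capacity (not β)) (card Far) (card Near)
          (≤-<-trans Far-over (≤-<-trans (double-counting Far Near (colourClass E c (not β)) Far→Near) Near-under))

    start : Fin n → Bool
    start = insert (λ _ → false) y

    explored-start : Explored start
    explored-start = record { root = update-here _≟ᶠ_ _ y true ; saturated = saturated ; reached = reached }
      where
      saturated : ∀ v → start v ≡ true → capacity (ρ v) ≤ load E c v (ρ v)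
      saturated v _ with v ≟ᶠ y
      saturated v _  | yes refl = subst (λ γ → capacity γ ≤ load E c v γ) (sym (ρ-same {y} refl))
                                    (≤-trans (n≤1+n _) (≤-reflexive (sym overloaded)))
      saturated v () | no _
      reached : ∀ v → start v ≡ true → Reached start v
      reached v _ with v ≟ᶠ y
      reached v _  | yes refl =
        c , (λ z γ → cong (load E c z γ +_) (+-comm (unit y (ρ y) z γ) (unit y (not (ρ y)) z γ))) , (λ _ _ _ → refl)
      reached v () | no _

    untouched-wider : ∀ {R w} c′ → Untouched R c′ → Untouched (insert R w) c′
    untouched-wider {R} {w} _ untouched u x (inj₁ outside) = untouched u x (inj₁ (insert-outside R w outside))
    untouched-wider         _ untouched u x (inj₂ tu≡tx)   = untouched u x (inj₂ tu≡tx)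

    -- The flipped arc v → w lies inside R ∪ {w} and is seen from both ends.
    untouched-after-flip : ∀ {R v w} c′ → Untouched R c′ → R v ≡ true → t v ≢ t w →
      Untouched (insert R w) (flip c′ (edge v w))
    untouched-after-flip {R} {v} {w} c′ untouched Rv tv≢tw u x unflipped =
      trans (update-there _≟ᵖ_ c′ (not (c′ (edge v w))) (not-flipped unflipped))
            (untouched-wider c′ untouched u x unflipped)
      where
      not-flipped : ∀ {u x} → insert R w x ≡ false ⊎ t u ≡ t x → edge u x ≢ edge v w
      not-flipped unflipped eq with edge-cases eq | unflipped
      ... | inj₁ (refl , refl) | inj₁ outside      with () ← trans (sym outside) (update-here _≟ᶠ_ R w true)
      ... | inj₁ (refl , refl) | inj₂ tv≡tw        = tv≢tw tv≡tw
      ... | inj₂ (refl , refl , _) | inj₁ outside  with () ← trans (sym outside) (insert-⊇ R w Rv)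
      ... | inj₂ (refl , refl , tw≢tv) | inj₂ tw≡tv = tw≢tv tw≡tv

    explore-step : ∀ {R v w} → Explored R → R v ≡ true → Arc c v w → t w ≢ t v → R w ≡ false →
      capacity (ρ w) ≤ load E c w (ρ w) → Explored (insert R w)
    explore-step {R} {v} {w} explored Rv (isEdge , colour) tw≢tv Rw full = record
      { root      = insert-⊇ R w root
      ; saturated = saturated′
      ; reached   = reached′
      }
      where
      open Explored explored
      tv≢tw : t v ≢ t w
      tv≢tw tv≡tw = tw≢tv (sym tv≡tw)
      saturated′ : ∀ x → insert R w x ≡ true → capacity (ρ x) ≤ load E c x (ρ x)
      saturated′ x Rx with x ≟ᶠ w
      ... | yes refl = full
      ... | no _     = saturated x Rx
      reached′ : ∀ x → insert R w x ≡ true → Reached (insert R w) x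
      reached′ x Rx with x ≟ᶠ w | reached v Rv
      ... | yes refl | cᵥ , transfer , untouched =
        flip cᵥ (edge v x) ,
        transfer-onward cᵥ (flip cᵥ (edge v x)) transfer
          (flip-arc cᵥ (isEdge , trans (untouched v x (inj₁ Rw)) colour) tv≢tw) ,
        untouched-after-flip cᵥ untouched Rv tv≢tw
      ... | no _ | _ with reached x Rx
      ... | cₓ , transfer , untouched = cₓ , transfer , untouched-wider cₓ untouched

    Exit : (Fin n → Bool) → Fin n → Fin n → Set
    Exit R v w = R v ≡ true × Arc c v w × (t w ≡ t v ⊎ R w ≡ false)

    exit? : ∀ R → Dec (∃ λ v → ∃ λ w → Exit R v w)
    exit? R = any? λ v → any? λ w →
      (R v ≟ᵇ true) ×-dec ((E (edge v w) ≟ᵇ true) ×-dec (c (edge v w) ≟ᵇ ρ v))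
                   ×-dec ((t w ≟ᵇ t v) ⊎-dec (R w ≟ᵇ false))

    closed-without-exit : ∀ {R} → ¬ (∃ λ v → ∃ λ w → Exit R v w) → Closed R
    closed-without-exit noExit v w Rv arc =
      (λ tw≡tv → noExit (v , w , Rv , arc , inj₁ tw≡tv)) ,
      ¬-not (λ Rw≡false → noExit (v , w , Rv , arc , inj₂ Rw≡false))

    release : ∀ {R v w} → Reached R v → Arc c v w → t w ≡ t v → Σ Colouring (Valid E)
    release {v = v} {w} (cᵥ , transfer , untouched) (isEdge , colour) tw≡tv =
      flip cᵥ (edge v w) ,
      valid-after E c (flip cᵥ (edge v w))
        (transfer-release cᵥ (flip cᵥ (edge v w)) transfer
           (flip-blind-arc cᵥ (isEdge , trans (untouched v w (inj₂ (sym tw≡tv))) colour) (sym tw≡tv)))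
        fits-released

    hand-over : ∀ {R v w} → R y ≡ true → Reached R v → Arc c v w → t w ≢ t v → R w ≡ false →
      load E c w (ρ w) < capacity (ρ w) → Σ Colouring (Valid E)
    hand-over {v = v} {w} Ry (cᵥ , transfer , untouched) (isEdge , colour) tw≢tv Rw room =
      flip cᵥ (edge v w) ,
      valid-after E c (flip cᵥ (edge v w))
        (transfer-onward cᵥ (flip cᵥ (edge v w)) transfer
           (flip-arc cᵥ (isEdge , trans (untouched v w (inj₁ Rw)) colour) (λ tv≡tw → tw≢tv (sym tv≡tw))))
        (fits-transferred w≢y room)
      where
      w≢y : w ≢ y
      w≢y refl with () ← trans (sym Rw) Ry

    -- The search grows R by one vertex per round, so n rounds suffice.
    search : ∀ fuel R → Explored R → n ≤ card R + fuel → Σ Colouring (Valid E)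
    grow : ∀ fuel R w → Explored (insert R w) → R w ≡ false → n ≤ card R + fuel → Σ Colouring (Valid E)

    search fuel R explored bound with exit? R
    ... | no noExit = ⊥-elim (Counting.impossible explored (closed-without-exit noExit))
    ... | yes (v , w , Rv , arc , leaves) with t w ≟ᵇ t v
    ...   | yes tw≡tv = release (Explored.reached explored v Rv) arc tw≡tv
    ...   | no tw≢tv with leaves | load E c w (ρ w) <? capacity (ρ w)
    ...     | inj₁ tw≡tv | _        = contradiction tw≡tv tw≢tv
    ...     | inj₂ Rw    | yes room =
              hand-over (Explored.root explored) (Explored.reached explored v Rv) arc tw≢tv Rw room
    ...     | inj₂ Rw    | no full  =
              grow fuel R w (explore-step explored Rv arc tw≢tv Rw (≮⇒≥ full)) Rw bound

    grow zero R w _ Rw bound = contradiction too-many (<-irrefl refl)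
      where
      too-many : card R < card R
      too-many = begin-strict
        card R            <⟨ n<1+n (card R) ⟩
        suc (card R)      ≡⟨ card-insert R w Rw ⟨
        card (insert R w) ≤⟨ card-≤ (insert R w) ⟩
        n                 ≤⟨ bound ⟩
        card R + 0        ≡⟨ +-identityʳ (card R) ⟩
        card R            ∎
        where open ≤-Reasoning
    grow (suc fuel) R w explored Rw bound = search fuel (insert R w) explored more
      where
      more : n ≤ card (insert R w) + fuel
      more = ≤-trans bound (≤-reflexive (trans (+-suc (card R) fuel) (cong (_+ fuel) (sym (card-insert R w Rw)))))

    repair : Σ Colouring (Valid E)
    repair = search n start explored-start (m≤n+m n (card start))

  module Extension (E E⁺ : Graph) (q : Pair) (new : E q ≡ false) (added : E⁺ q ≡ true)
      (same : ∀ Q → Q ≢ q → E⁺ Q ≡ E Q)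
      (bounded : ∀ z → degree E⁺ z ≤ capacity true + capacity false)
      (c : Colouring) (valid : Valid E c) where

    class-agrees : ∀ γ β Q → Q ≢ q → colourClass E⁺ (c [ q ≔ γ ]) β Q ≡ colourClass E c β Q
    class-agrees γ β Q Q≢q = cong₂ (λ e x → e ∧ (β == x)) (same Q Q≢q) (update-there _≟ᵖ_ c γ Q≢q)

    load-at-viewer : ∀ γ β {z u₀} → edge z u₀ ≡ q → load E⁺ (c [ q ≔ γ ]) z β ≡ load E c z β + ι (β == γ)
    load-at-viewer γ β {z} sees = begin
      load E⁺ (c [ q ≔ γ ]) z β
        ≡⟨ +-identityʳ _ ⟨
      load E⁺ (c [ q ≔ γ ]) z β + 0
        ≡⟨ cong (λ e → load E⁺ (c [ q ≔ γ ]) z β + ι (e ∧ (β == c q))) new ⟨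
      load E⁺ (c [ q ≔ γ ]) z β + ι (colourClass E c β q)
        ≡⟨ seen-update (class-agrees γ β) sees ⟩
      load E c z β + ι (colourClass E⁺ (c [ q ≔ γ ]) β q)
        ≡⟨ cong₂ (λ e x → load E c z β + ι (e ∧ (β == x))) added (update-here _≟ᵖ_ c q γ) ⟩
      load E c z β + ι (β == γ) ∎
      where open ≡-Reasoning

    load-elsewhere : ∀ γ β {z} → (∀ u → edge z u ≢ q) → load E⁺ (c [ q ≔ γ ]) z β ≡ load E c z β
    load-elsewhere γ β unseen = seen-unchanged (class-agrees γ β) unseen

    room-before : ∀ {a b} → edge a b ≡ q → load E c a true + load E c a false < capacity true + capacity false
    room-before {a} seenBy = begin-strict
      load E c a true + load E c a false ≡⟨ load-split E c a true ⟩
      degree E a                         <⟨ m<m+n (degree E a) z<s ⟩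
      degree E a + 1                     ≡⟨ cong (degree E a +_) (cong ι added) ⟨
      degree E a + ι (E⁺ q)              ≡⟨ seen-update same seenBy ⟨
      degree E⁺ a + ι (E q)              ≡⟨ cong (λ e → degree E⁺ a + ι e) new ⟩
      degree E⁺ a + 0                    ≡⟨ +-identityʳ _ ⟩
      degree E⁺ a                        ≤⟨ bounded a ⟩
      capacity true + capacity false     ∎
      where open ≤-Reasoning

    free-colour : ∀ {a b} → edge a b ≡ q → Σ Bool λ γ → load E c a γ < capacity γ
    free-colour seenBy with one-below (room-before seenBy)
    ... | inj₁ room = true , room
    ... | inj₂ room = false , room

    valid-at : ∀ {a b} γ → edge a b ≡ q → load E c a γ < capacity γ → ∀ z →
      (z ≡ b → t a ≢ t b → load E c b γ < capacity γ) → ValidAt E⁺ (c [ q ≔ γ ]) z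
    valid-at {a} {b} γ seenBy room-a z room-b β with any? (λ u → edge z u ≟ᵖ q)
    ... | no unseen = ≤-trans (≤-reflexive (load-elsewhere γ β (λ u sees → unseen (u , sees)))) (valid z β)
    ... | yes (u , sees) with edge-cases (trans sees (sym seenBy))
    ...   | inj₁ (refl , _) =
            ≤-trans (≤-reflexive (load-at-viewer γ β sees)) (add-unit-fits γ room-a (valid z) β)
    ...   | inj₂ (refl , _ , tb≢ta) =
            ≤-trans (≤-reflexive (load-at-viewer γ β sees))
                    (add-unit-fits γ (room-b refl (λ ta≡tb → tb≢ta (sym ta≡tb))) (valid z) β)

    extend : Σ Colouring (Valid E⁺)
    extend with any? (λ a → any? (λ b → edge a b ≟ᵖ q))
    ... | no unseen =
      c [ q ≔ true ] ,
      λ z β → ≤-trans (≤-reflexive (load-elsewhere true β (λ u sees → unseen (z , u , sees)))) (valid z β)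
    ... | yes (a , b , seenBy) with free-colour seenBy
    ...   | γ , room-a with t a ≟ᵇ t b | load E c b γ <? capacity γ
    ...     | yes ta≡tb | _ =
              c [ q ≔ γ ] , λ z → valid-at γ seenBy room-a z (λ _ ta≢tb → contradiction ta≡tb ta≢tb)
    ...     | no _ | yes room-b =
              c [ q ≔ γ ] , λ z → valid-at γ seenBy room-a z (λ _ _ → room-b)
    ...     | no ta≢tb | no full =
              Repair.repair E⁺ (c [ q ≔ γ ]) b γ
                (λ z z≢b → valid-at γ seenBy room-a z (λ z≡b → contradiction z≡b z≢b))
                over (spare-when-over E⁺ (c [ q ≔ γ ]) b γ (bounded b) over)
      where
      over : load E⁺ (c [ q ≔ γ ]) b γ ≡ suc (capacity γ)
      over = begin
        load E⁺ (c [ q ≔ γ ]) b γ ≡⟨ load-at-viewer γ γ (trans (edge-shared ta≢tb) seenBy) ⟩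
        load E c b γ + ι (γ == γ) ≡⟨ cong₂ (λ l x → l + ι x) (≤-antisym (valid b γ) (≮⇒≥ full)) (==-refl γ) ⟩
        capacity γ + 1            ≡⟨ +-comm (capacity γ) 1 ⟩
        suc (capacity γ)          ∎
        where open ≡-Reasoning

  -- Add the edges of D one pair at a time, along a list of all pairs.

  module Global (D : Graph) (bounded : ∀ z → degree D z ≤ capacity true + capacity false) where

    restrict : List Pair → Graph
    restrict []      = λ _ → false
    restrict (q ∷ L) = restrict L [ q ≔ D q ]

    restrict-⊆ : ∀ L Q → restrict L Q ≡ true → D Q ≡ true
    restrict-⊆ (q ∷ L) Q inL with Q ≟ᵖ q
    ... | yes refl = inL
    ... | no _     = restrict-⊆ L Q inL

    restrict-∈ : ∀ L Q → Q ∈ L → restrict L Q ≡ D Q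
    restrict-∈ (q ∷ L) Q Q∈ with Q ≟ᵖ q | Q∈
    ... | yes refl | _         = refl
    ... | no Q≢q   | here Q≡q  = contradiction Q≡q Q≢q
    ... | no _     | there Q∈L = restrict-∈ L Q Q∈L

    valid-cong : ∀ {E E′} c → (∀ Q → E Q ≡ E′ Q) → Valid E c → Valid E′ c
    valid-cong c E≗E′ valid z β =
      ≤-trans (≤-reflexive (sum-cong-≗ (λ u → cong (λ e → ι (e ∧ (β == c (edge z u)))) (sym (E≗E′ (edge z u))))))
              (valid z β)

    colour-prefix : ∀ L → Σ Colouring (Valid (restrict L))
    colour-prefix []      = (λ _ → true) , λ z β → subst (_≤ capacity β) (sym (sum-replicate-zero n)) z≤n
    colour-prefix (q ∷ L) with colour-prefix L | restrict L q ≟ᵇ D q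
    ... | c , valid | yes unchanged = c , valid-cong c same-graph valid
      where
      same-graph : ∀ Q → restrict L Q ≡ restrict (q ∷ L) Q
      same-graph Q with Q ≟ᵖ q
      ... | yes refl = unchanged
      ... | no _     = refl
    ... | c , valid | no changed =
      Extension.extend (restrict L) (restrict (q ∷ L)) q new added
        (λ Q Q≢q → update-there _≟ᵖ_ (restrict L) (D q) Q≢q)
        (λ z → ≤-trans (seen-mono z (restrict-⊆ (q ∷ L))) (bounded z))
        c valid
      where
      new : restrict L q ≡ false
      new = ¬-not (λ inL → changed (trans inL (sym (restrict-⊆ L q inL))))
      added : restrict (q ∷ L) q ≡ true
      added = trans (update-here _≟ᵖ_ (restrict L) q (D q)) (¬-not (λ notD → changed (trans new (sym notD))))

    allPairs : List Pair
    allPairs = cartesianProduct (List.allFin n) (List.allFin n)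

    every-pair : ∀ Q → Q ∈ allPairs
    every-pair (a , b) = ∈-cartesianProduct⁺ (∈-allFin a) (∈-allFin b)

    colour-all : Σ Colouring (Valid D)
    colour-all with colour-prefix allPairs
    ... | c , valid = c , valid-cong c (λ Q → restrict-∈ allPairs Q (every-pair Q)) valid

count-tabulate : ∀ {A : Set} {m} (g : Fin m → A) (f : A → Bool) →
  count (λ a → f a ≟ᵇ true) (tabulate g) ≡ ∑[ i < m ] ι (f (g i))
count-tabulate {m = zero}  g f = refl
count-tabulate {m = suc m} g f with f (g zero)
... | true  = cong suc (count-tabulate (g ∘ suc) f)
... | false = count-tabulate (g ∘ suc) f

-- The colour classes of a valid colouring of D, for the vertex types "indegree at most
-- p₁ + p₂" and capacities p₁ (colour true) and p₂ (colour false).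
module DigraphColouring (p₁ p₂ : ℕ) {n : ℕ} (D : Digraph n) (inD : InD (p₁ + p₂) (p₁ + p₂) D) where

  capacity : Bool → ℕ
  capacity β = if β then p₁ else p₂

  byIndegree : Fin n → Bool
  byIndegree v = does (indeg D v ≤? p₁ + p₂)

  open Colourings byIndegree capacity

  indeg-seen : ∀ (F : Digraph n) {v} → byIndegree v ≡ true → indeg F v ≡ seen (uncurry F) v
  indeg-seen F {v} tv =
    trans (count-tabulate (λ u → u) (λ u → F u v)) (sum-cong-≗ (λ u → cong (ι ∘ uncurry F) (sym (edge-in u tv))))

  outdeg-seen : ∀ (F : Digraph n) {v} → byIndegree v ≡ false → outdeg F v ≡ seen (uncurry F) v
  outdeg-seen F {v} tv =
    trans (count-tabulate (λ u → u) (λ u → F v u)) (sum-cong-≗ (λ u → cong (ι ∘ uncurry F) (sym (edge-out u tv))))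

  bounded : ∀ v → degree (uncurry D) v ≤ p₁ + p₂
  bounded v with indeg D v ≤? p₁ + p₂ in tv
  ... | yes small = subst (_≤ p₁ + p₂) (indeg-seen D (cong does tv)) small
  ... | no big with inD v
  ...   | inj₁ small = contradiction small big
  ...   | inj₂ small = subst (_≤ p₁ + p₂) (outdeg-seen D (cong does tv)) small

  colouring : Σ Colouring (Valid (uncurry D))
  colouring = Global.colour-all (uncurry D) bounded

  class : Bool → Digraph n
  class β u w = colourClass (uncurry D) (proj₁ colouring) β (u , w)

  class-InD : ∀ β → InD (capacity β) (capacity β) (class β)
  class-InD β v with byIndegree v in tv
  ... | true  = inj₁ (subst (_≤ capacity β) (sym (indeg-seen (class β) tv)) (proj₂ colouring v β))
  ... | false = inj₂ (subst (_≤ capacity β) (sym (outdeg-seen (class β) tv)) (proj₂ colouring v β))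

  classes-partition : EdgePartition D (class true) (class false)
  classes-partition u w with D u w | proj₁ colouring (u , w)
  ... | true  | true  = inj₁ (refl , inj₁ (refl , refl))
  ... | true  | false = inj₁ (refl , inj₂ (refl , refl))
  ... | false | _     = inj₂ (refl , refl , refl)

-- Loops need no special care: a loop is seen once by its vertex, like any other edge.
theorem8 : (p₁ p₂ n : ℕ) (D : Digraph n) → Loopless D → InD (p₁ + p₂) (p₁ + p₂) D →
    Σ (Digraph n) λ D₁ → Σ (Digraph n) λ D₂ →
      EdgePartition D D₁ D₂ × InD p₁ p₁ D₁ × InD p₂ p₂ D₂
theorem8 p₁ p₂ n D _ inD =
  class true , class false , classes-partition , class-InD true , class-InD false
  where open DigraphColouring p₁ p₂ D inD
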